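{- Let $\Pi$ be a partition of $[n]$ with at least two blocks and no blocks of size $1$. Then $\zeta_n\in\mathrm{Aut}\,\Pi$ if and only if $\{1,\dots,n\}$ is a union of interwoven $\Pi$-blocks.
   Context: $[n]=\{1,\dots,n\}$, $\zeta_n=(1\,2\,\cdots\,n)$ is the natural cycle. For a partition $\Pi$ of $[n]$, $\mathrm{Aut}\,\Pi=\{\pi\in S_n:\pi(B)\in\Pi\text{ for all }B\in\Pi\}$. An interval $\{a,\dots,b\}\subseteq[n]$ is a union of interwoven $\Pi$-blocks if there are integers $k>1$, $\ell\ge1$ with $b-a+1=k\ell$ such that each set $\{a+i+mk: 0\le m<\ell\}$, $0\le i<k$, is a block of $\Pi$. -}

module Defs where

open import Data.Nat using (ℕ; zero; suc; _+_; _*_; _<_; _≤_)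
open import Data.Nat.DivMod using (_mod_)
open import Data.Fin using (Fin; toℕ)
open import Data.Fin.Subset using (Subset; _∈_; Nonempty)
open import Data.List using (List; length; lookup)
open import Data.Product using (Σ; ∃; ∃-syntax; _×_; _,_)
open import Function.Bundles using (_⇔_)
open import Relation.Binary.PropositionalEquality using (_≡_)

-- Points of [n] are modelled 0-indexed as Fin n (point i+1 of the paper ↔ i : Fin n).

record IsPartition {n : ℕ} (Π : List (Subset n)) : Set where
  field
    nonempty : ∀ p → Nonempty (lookup Π p)
    covers   : ∀ (j : Fin n) → ∃[ p ] (j ∈ lookup Π p)
    disjoint : ∀ (j : Fin n) p q → j ∈ lookup Π p → j ∈ lookup Π q → p ≡ q

IsBlock : {n : ℕ} → List (Subset n) → (Fin n → Set) → Set
IsBlock {n} Π X = ∃[ p ] (∀ (j : Fin n) → (j ∈ lookup Π p) ⇔ X j)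

Image : {n : ℕ} → (Fin n → Fin n) → Subset n → (Fin n → Set)
Image π B j = ∃[ i ] (i ∈ B × π i ≡ j)

InAut : {n : ℕ} → (Fin n → Fin n) → List (Subset n) → Set
InAut π Π = ∀ p → IsBlock Π (Image π (lookup Π p))

ζ : {n : ℕ} → Fin n → Fin n
ζ {suc m} i = suc (toℕ i) mod (suc m)

InterwovenUnion : {n : ℕ} → List (Subset n) → ℕ → ℕ → Set
InterwovenUnion {n} Π a b =
  Σ ℕ λ k → Σ ℕ λ ℓ →
    (1 < k) × (1 ≤ ℓ) × (suc b ≡ a + k * ℓ) ×
    (∀ i → i < k →
       IsBlock Π (λ j → ∃[ m ] (m < ℓ × toℕ j ≡ a + i + m * k)))

module Submission where

-- Both sides are compared with a third condition: for some positive
-- divisor k of n, every residue class modulo k is a block of Π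
-- ('ResidueBlocks').  An interwoven union with parameters k, ℓ (n = kℓ)
-- is literally this condition, because {i + ck : c < ℓ} is the residue
-- class of i in [0, kℓ) ('interwoven⇒residues', 'residues⇒interwoven';
-- the hypothesis of two blocks rules out k = 1).
--   ⇐ ζ maps the residue class of r onto that of r + 1 ('residues⇒aut').
--   ⇒ The map a ↦ (block of a mod n) on ℕ is n-periodic and, since ζ
--     preserves "lying in a common block", compatible with a ↦ a + 1.
--     The kernel of such a map is congruence modulo its least positive
--     period k, which divides n ('PeriodicKernel'); so the blocks are
--     exactly the residue classes modulo k ('aut⇒residues').

open import Defs
open import Data.Nat using (ℕ; _≤_; _∸_)
open import Data.Fin.Subset using (Subset; ∣_∣)
open import Data.List using (List; length; lookup)
open import Function.Bundles using (_⇔_)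

open import Data.Nat using (zero; suc; _+_; _*_; _<_; _%_; _/_; z≤n; s≤s; NonZero)
open import Data.Nat.Properties
  using (+-suc; +-comm; +-assoc; +-identityʳ; *-comm; ≤-total; ≤-<-trans; m∸n≤m; m+[n∸m]≡n)
open import Data.Nat.DivMod
open import Data.Nat.Divisibility using (_∣_; divides; ∣-refl; m%n≡0⇒n∣m)
open import Data.Fin using (Fin; toℕ; fromℕ<)
import Data.Fin as Fin
open import Data.Fin.Properties using (toℕ-injective; toℕ<n; toℕ-fromℕ<; ¬Fin0) renaming (_≟_ to _≟ᶠ_)
open import Data.Fin.Subset using (_∈_)
open import Data.Product using (∃-syntax; _×_; _,_; proj₁; proj₂)
open import Data.Sum using (inj₁; inj₂)
open import Data.Empty using (⊥-elim)
open import Function using (_∘_)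
open import Function.Bundles using (mk⇔; Equivalence)
open import Function.Properties.Equivalence using () renaming (sym to ⇔-sym; trans to ⇔-trans)
open import Relation.Binary.Definitions using (DecidableEquality)
open import Relation.Binary.PropositionalEquality
open import Relation.Nullary using (¬_; yes; no)
open import Relation.Unary using (Decidable)

open Equivalence using (to; from)

least-witness : (P : ℕ → Set) → Decidable P → ∀ t → P t →
                ∃[ k ] (P k × ∀ j → j < k → ¬ P j)
least-witness P P? t pt with P? 0
... | yes p0 = 0 , p0 , λ _ ()
least-witness P P? zero    pt | no ¬p0 = ⊥-elim (¬p0 pt)
least-witness P P? (suc t) pt | no ¬p0 with least-witness (P ∘ suc) (P? ∘ suc) t pt
... | k , pk , below = suc k , pk , λ { zero _ → ¬p0 ; (suc j) (s≤s j<k) → below j j<k }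

%-suc : ∀ a k .{{_ : NonZero k}} → suc a % k ≡ suc (a % k) % k
%-suc a k = begin
  suc a % k                           ≡⟨ cong (λ x → suc x % k) (m≡m%n+[m/n]*n a k) ⟩
  (suc (a % k) + (a / k) * k) % k     ≡⟨ [m+kn]%n≡m%n (suc (a % k)) (a / k) k ⟩
  suc (a % k) % k                     ∎
  where open ≡-Reasoning

%-suc-injective : ∀ a b k′ → suc a % suc k′ ≡ suc b % suc k′ → a % suc k′ ≡ b % suc k′
%-suc-injective a b k′ e = begin
  a % k                      ≡˘⟨ [m+n]%n≡m%n a k ⟩
  (a + k) % k                ≡⟨ cong (_% k) (+-suc a k′) ⟩
  (suc a + k′) % k           ≡⟨ %-distribˡ-+ (suc a) k′ k ⟩
  (suc a % k + k′ % k) % k   ≡⟨ cong (λ x → (x + k′ % k) % k) e ⟩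
  (suc b % k + k′ % k) % k   ≡˘⟨ %-distribˡ-+ (suc b) k′ k ⟩
  (suc b + k′) % k           ≡˘⟨ cong (_% k) (+-suc b k′) ⟩
  (b + k) % k                ≡⟨ [m+n]%n≡m%n b k ⟩
  b % k                      ∎
  where
  open ≡-Reasoning
  k = suc k′

progression⇔residue : ∀ {k ℓ x i} .{{_ : NonZero k}} → x < ℓ * k → i < k →
                      (∃[ c ] (c < ℓ × x ≡ i + c * k)) ⇔ (x % k ≡ i)
progression⇔residue {k} {ℓ} {x} {i} x<ℓk i<k = mk⇔ inProgression⇒residue residue⇒inProgression
  where
  inProgression⇒residue : ∃[ c ] (c < ℓ × x ≡ i + c * k) → x % k ≡ i
  inProgression⇒residue (c , _ , x≡) =
    trans (cong (_% k) x≡) (trans ([m+kn]%n≡m%n i c k) (m<n⇒m%n≡m i<k))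
  residue⇒inProgression : x % k ≡ i → ∃[ c ] (c < ℓ × x ≡ i + c * k)
  residue⇒inProgression x%k≡i =
    x / k , m<n*o⇒m/o<n x<ℓk , trans (m≡m%n+[m/n]*n x k) (cong (_+ (x / k) * k) x%k≡i)

module PeriodicKernel {B : Set} (_≟_ : DecidableEquality B) (f : ℕ → B) (m : ℕ)
  (periodic : ∀ a → f (suc m + a) ≡ f a)
  (shift : ∀ {a b} → f a ≡ f b → f (suc a) ≡ f (suc b)) where

  N : ℕ
  N = suc m

  shiftBy : ∀ t {a b} → f a ≡ f b → f (t + a) ≡ f (t + b)
  shiftBy zero    e = e
  shiftBy (suc t) e = shift (shiftBy t e)

  -- Periodicity makes the shift invertible.
  unshift : ∀ {a b} → f (suc a) ≡ f (suc b) → f a ≡ f b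
  unshift {a} {b} e = begin
    f a            ≡˘⟨ periodic a ⟩
    f (N + a)      ≡˘⟨ cong f (+-suc m a) ⟩
    f (m + suc a)  ≡⟨ shiftBy m e ⟩
    f (m + suc b)  ≡⟨ cong f (+-suc m b) ⟩
    f (N + b)      ≡⟨ periodic b ⟩
    f b            ∎
    where open ≡-Reasoning

  -- Hence whether d is a period does not depend on the base point.
  cancel : ∀ a {d} → f a ≡ f (a + d) → f 0 ≡ f d
  cancel zero    e = e
  cancel (suc a) e = cancel a (unshift e)

  -- N is a positive period, so a least positive period k = suc k₀ exists.
  leastPeriod : ∃[ k₀ ] (f 0 ≡ f (suc k₀) × ∀ j → j < k₀ → ¬ f 0 ≡ f (suc j))
  leastPeriod = least-witness (λ t → f 0 ≡ f (suc t)) (λ t → f 0 ≟ f (suc t)) m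
                  (sym (trans (cong f (sym (+-identityʳ N))) (periodic 0)))

  k₀ : ℕ
  k₀ = proj₁ leastPeriod

  k : ℕ
  k = suc k₀

  minimal : ∀ d → d < k → f 0 ≡ f d → d ≡ 0
  minimal zero    _          _ = refl
  minimal (suc j) (s≤s j<k₀) e = ⊥-elim (proj₂ (proj₂ leastPeriod) j j<k₀ e)

  addPeriod : ∀ a → f a ≡ f (k + a)
  addPeriod a = trans (cong f (sym (+-identityʳ a)))
                  (trans (shiftBy a (proj₁ (proj₂ leastPeriod))) (cong f (+-comm a k)))

  addMultiple : ∀ c a → f a ≡ f (c * k + a)
  addMultiple zero    a = refl
  addMultiple (suc c) a =
    trans (addMultiple c a) (trans (addPeriod (c * k + a)) (cong f (sym (+-assoc k (c * k) a))))

  toResidue : ∀ a → f (a % k) ≡ f a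
  toResidue a = trans (addMultiple (a / k) (a % k))
    (cong f (trans (+-comm (a / k * k) (a % k)) (sym (m≡m%n+[m/n]*n a k))))

  -- Distinct residues lie in distinct fibres, by minimality of k.
  residue-injective : ∀ {r s} → r ≤ s → s < k → f r ≡ f s → r ≡ s
  residue-injective {r} {s} r≤s s<k e = begin
    r                ≡˘⟨ +-identityʳ r ⟩
    r + 0            ≡˘⟨ cong (r +_) d≡0 ⟩
    r + (s ∸ r)      ≡⟨ m+[n∸m]≡n r≤s ⟩
    s                ∎
    where
    open ≡-Reasoning
    d≡0 : s ∸ r ≡ 0
    d≡0 = minimal (s ∸ r) (≤-<-trans (m∸n≤m s r) s<k)
            (cancel r (trans e (cong f (sym (m+[n∸m]≡n r≤s)))))

  kernel : ∀ a b → f a ≡ f b ⇔ a % k ≡ b % k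
  kernel a b = mk⇔ sameFibre⇒sameResidue sameResidue⇒sameFibre
    where
    sameResidue⇒sameFibre : a % k ≡ b % k → f a ≡ f b
    sameResidue⇒sameFibre e = trans (sym (toResidue a)) (trans (cong f e) (toResidue b))
    sameFibre⇒sameResidue : f a ≡ f b → a % k ≡ b % k
    sameFibre⇒sameResidue e with ≤-total (a % k) (b % k)
    ... | inj₁ a≤b = residue-injective a≤b (m%n<n b k)
                     (trans (toResidue a) (trans e (sym (toResidue b))))
    ... | inj₂ b≤a = sym (residue-injective b≤a (m%n<n a k)
                     (trans (toResidue b) (trans (sym e) (sym (toResidue a)))))

  -- Since f 0 ≡ f N, the period N is a multiple of k.
  k∣N : k ∣ N
  k∣N = m%n≡0⇒n∣m N k (sym (to (kernel 0 N)
          (trans (sym (periodic 0)) (cong f (+-identityʳ N)))))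

ResidueBlocks : ∀ {n} → List (Subset n) → (k : ℕ) .{{_ : NonZero k}} → Set
ResidueBlocks Π k = ∀ i → i < k → IsBlock Π (λ j → toℕ j % k ≡ i)

IsBlock-cong : ∀ {n} {Π : List (Subset n)} {X Y : Fin n → Set} →
               IsBlock Π X → (∀ j → X j ⇔ Y j) → IsBlock Π Y
IsBlock-cong (p , p⇔X) X⇔Y = p , λ j → ⇔-trans (p⇔X j) (X⇔Y j)

Fin-nontrivial : ∀ {L} → 2 ≤ L → ¬ (∀ (p q : Fin L) → p ≡ q)
Fin-nontrivial (s≤s (s≤s _)) allEqual with allEqual Fin.zero (Fin.suc Fin.zero)
... | ()

module Partition {n : ℕ} {Π : List (Subset n)} (isP : IsPartition Π) where
  open IsPartition isP

  blockOf : Fin n → Fin (length Π)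
  blockOf j = proj₁ (covers j)

  ∈⇔blockOf : ∀ j p → j ∈ lookup Π p ⇔ blockOf j ≡ p
  ∈⇔blockOf j p = mk⇔ (disjoint j (blockOf j) p (proj₂ (covers j))) λ { refl → proj₂ (covers j) }

  block-unique : ∀ {X} → IsBlock Π X → ∀ {p x} → x ∈ lookup Π p → X x →
                 ∀ j → j ∈ lookup Π p ⇔ X j
  block-unique (q , q⇔X) {p} {x} x∈p Xx j =
    subst (λ r → j ∈ lookup Π r ⇔ _) (disjoint x q p (from (q⇔X x) Xx) x∈p) (q⇔X j)

  no-whole-block : 2 ≤ length Π → ∀ {X} → (∀ j → X j) → ¬ IsBlock Π X
  no-whole-block two all (p , p⇔X) =
    Fin-nontrivial two λ q r → trans (everyBlockIs q) (sym (everyBlockIs r))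
    where
    everyBlockIs : ∀ q → q ≡ p
    everyBlockIs q = let (x , x∈q) = nonempty q in
      disjoint x q p x∈q (from (p⇔X x) (all x))

  aut-sameBlock : ∀ {π} → InAut π Π →
                  ∀ {i j} → blockOf i ≡ blockOf j → blockOf (π i) ≡ blockOf (π j)
  aut-sameBlock {π} aut {i} {j} same =
    trans (inImageBlock i refl) (sym (inImageBlock j (sym same)))
    where
    q = proj₁ (aut (blockOf i))
    inImageBlock : ∀ x → blockOf x ≡ blockOf i → blockOf (π x) ≡ q
    inImageBlock x e = to (∈⇔blockOf (π x) q)
      (from (proj₂ (aut (blockOf i)) (π x)) (x , from (∈⇔blockOf x (blockOf i)) e , refl))

  -- A residue class modulo 1 is everything, so two blocks force k > 1.
  modulus>1 : 2 ≤ length Π → ∀ k′ → ResidueBlocks Π (suc k′) → 1 < suc k′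
  modulus>1 two zero    residues =
    ⊥-elim (no-whole-block two (λ j → n%1≡0 (toℕ j)) (residues 0 (s≤s z≤n)))
  modulus>1 two (suc _) _        = s≤s (s≤s z≤n)

module Cycle (m : ℕ) where
  N : ℕ
  N = suc m

  ⟦_⟧ : ℕ → Fin N
  ⟦ a ⟧ = a mod N

  toℕ-⟦⟧ : ∀ a → toℕ ⟦ a ⟧ ≡ a % N
  toℕ-⟦⟧ a = toℕ-fromℕ< (m%n<n a N)

  ⟦⟧-cong : ∀ {a b} → a % N ≡ b % N → ⟦ a ⟧ ≡ ⟦ b ⟧
  ⟦⟧-cong {a} {b} e = toℕ-injective (trans (toℕ-⟦⟧ a) (trans e (sym (toℕ-⟦⟧ b))))

  ⟦toℕ⟧ : ∀ j → ⟦ toℕ j ⟧ ≡ j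
  ⟦toℕ⟧ j = toℕ-injective (trans (toℕ-⟦⟧ (toℕ j)) (m<n⇒m%n≡m (toℕ<n j)))

  ζ-⟦⟧ : ∀ a → ζ ⟦ a ⟧ ≡ ⟦ suc a ⟧
  ζ-⟦⟧ a = ⟦⟧-cong {suc (toℕ ⟦ a ⟧)} {suc a}
    (trans (cong (λ x → suc x % N) (toℕ-⟦⟧ a)) (sym (%-suc a N)))

  -- ζ is onto: the point before j is j + m (mod N).
  ζ-onto : ∀ j → ζ ⟦ toℕ j + m ⟧ ≡ j
  ζ-onto j =
    trans (ζ-⟦⟧ (toℕ j + m)) (trans (⟦⟧-cong {suc (toℕ j + m)} {toℕ j} j+N≡j) (⟦toℕ⟧ j))
    where
    j+N≡j : suc (toℕ j + m) % N ≡ toℕ j % N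
    j+N≡j = trans (cong (_% N) (sym (+-suc (toℕ j) m))) ([m+n]%n≡m%n (toℕ j) N)

  ζ-residue : ∀ {k} .{{_ : NonZero k}} → k ∣ N → ∀ i → toℕ (ζ i) % k ≡ suc (toℕ i) % k
  ζ-residue {k} k∣N i =
    trans (cong (_% k) (toℕ-⟦⟧ (suc (toℕ i)))) (m∣n⇒o%n%m≡o%m k N (suc (toℕ i)) k∣N)

  image-of-class : ∀ k′ → suc k′ ∣ N → ∀ {B : Subset N} {r} → r < suc k′ →
                   (∀ i → i ∈ B ⇔ toℕ i % suc k′ ≡ r) →
                   ∀ j → Image ζ B j ⇔ toℕ j % suc k′ ≡ suc r % suc k′
  image-of-class k′ k∣N {B} {r} r<k B⇔r j = mk⇔ image⇒residue residue⇒image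
    where
    k = suc k′
    image⇒residue : Image ζ B j → toℕ j % k ≡ suc r % k
    image⇒residue (i , i∈B , ζi≡j) = begin
      toℕ j % k            ≡˘⟨ cong (λ x → toℕ x % k) ζi≡j ⟩
      toℕ (ζ i) % k        ≡⟨ ζ-residue k∣N i ⟩
      suc (toℕ i) % k      ≡⟨ %-suc (toℕ i) k ⟩
      suc (toℕ i % k) % k  ≡⟨ cong (λ x → suc x % k) (to (B⇔r i) i∈B) ⟩
      suc r % k            ∎
      where open ≡-Reasoning
    residue⇒image : toℕ j % k ≡ suc r % k → Image ζ B j
    residue⇒image e =
      i , from (B⇔r i) (trans (%-suc-injective (toℕ i) r k′ sucI) (m<n⇒m%n≡m r<k)) , ζ-onto j
      where
      i = ⟦ toℕ j + m ⟧
      sucI : suc (toℕ i) % k ≡ suc r % k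
      sucI = trans (sym (ζ-residue k∣N i)) (trans (cong (λ x → toℕ x % k) (ζ-onto j)) e)

module _ {m : ℕ} {Π : List (Subset (suc m))} where
  open Cycle m using (N)

  interwoven⇒residues : InterwovenUnion Π 0 m → ∃[ k′ ] (suc k′ ∣ N × ResidueBlocks Π (suc k′))
  interwoven⇒residues (zero , _ , () , _)
  interwoven⇒residues (suc k′ , ℓ , _ , _ , N≡kℓ , progressions) =
    k′ , divides ℓ N≡ℓk ,
    λ i i<k → IsBlock-cong {Π = Π} (progressions i i<k)
                (λ j → progression⇔residue (subst (toℕ j <_) N≡ℓk (toℕ<n j)) i<k)
    where
    N≡ℓk : N ≡ ℓ * suc k′
    N≡ℓk = trans N≡kℓ (*-comm (suc k′) ℓ)

  residues⇒interwoven : ∀ k′ → 1 < suc k′ → suc k′ ∣ N → ResidueBlocks Π (suc k′) →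
                        InterwovenUnion Π 0 m
  residues⇒interwoven k′ 1<k (divides zero ()) residues
  residues⇒interwoven k′ 1<k (divides ℓ@(suc _) N≡ℓk) residues =
    suc k′ , ℓ , 1<k , s≤s z≤n , trans N≡ℓk (*-comm ℓ (suc k′)) ,
    λ i i<k → IsBlock-cong {Π = Π} (residues i i<k)
                (λ j → ⇔-sym (progression⇔residue (subst (toℕ j <_) N≡ℓk (toℕ<n j)) i<k))

module _ {m : ℕ} {Π : List (Subset (suc m))} (isP : IsPartition Π) where
  open IsPartition isP
  open Partition isP
  open Cycle m

  -- ⇐: if the residue classes modulo a divisor k of N are blocks, then
  -- every block is such a class, and ζ maps it onto the next one.
  residues⇒aut : ∀ k′ → suc k′ ∣ N → ResidueBlocks Π (suc k′) → InAut ζ Π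
  residues⇒aut k′ k∣N residues p =
    IsBlock-cong {Π = Π} (residues (suc r % k) (m%n<n (suc r) k))
      (λ j → ⇔-sym (image-of-class k′ k∣N r<k p⇔r j))
    where
    k = suc k′
    x = proj₁ (nonempty p)
    r = toℕ x % k
    r<k = m%n<n (toℕ x) k
    p⇔r : ∀ i → i ∈ lookup Π p ⇔ toℕ i % k ≡ r
    p⇔r = block-unique (residues r r<k) (proj₂ (nonempty p)) refl

  -- ⇒: for ζ ∈ Aut Π, the map a ↦ (block of a mod N) satisfies the
  -- hypotheses of PeriodicKernel, so the blocks are residue classes.
  aut⇒residues : InAut ζ Π → ∃[ k₀ ] (suc k₀ ∣ N × ResidueBlocks Π (suc k₀))
  aut⇒residues aut = k₀ , k∣N , residueBlock
    where
    f : ℕ → Fin (length Π)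
    f a = blockOf ⟦ a ⟧
    periodic : ∀ a → f (N + a) ≡ f a
    periodic a = cong blockOf (⟦⟧-cong {N + a} {a} (%-remove-+ˡ a ∣-refl))
    shift : ∀ {a b} → f a ≡ f b → f (suc a) ≡ f (suc b)
    shift {a} {b} e =
      subst₂ (λ x y → blockOf x ≡ blockOf y) (ζ-⟦⟧ a) (ζ-⟦⟧ b) (aut-sameBlock aut e)
    open PeriodicKernel _≟ᶠ_ f m periodic shift
    residueBlock : ResidueBlocks Π k
    residueBlock i i<k = f i , λ j → ⇔-trans (∈⇔blockOf j (f i)) (sameBlock⇔residue j)
      where
      sameBlock⇔residue : ∀ j → blockOf j ≡ f i ⇔ toℕ j % k ≡ i
      sameBlock⇔residue j =
        subst (λ y → blockOf y ≡ f i ⇔ toℕ j % k ≡ i) (⟦toℕ⟧ j)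
          (subst (λ y → f (toℕ j) ≡ f i ⇔ toℕ j % k ≡ y) (m<n⇒m%n≡m i<k) (kernel (toℕ j) i))

lemma9p9 : (n : ℕ) (Π : List (Subset n)) → IsPartition Π → 2 ≤ length Π →
           (∀ p → 2 ≤ ∣ lookup Π p ∣) →
           InAut ζ Π ⇔ InterwovenUnion Π 0 (n ∸ 1)
-- The empty set has no blocks; otherwise combine the two directions
-- through ResidueBlocks.
lemma9p9 zero    Π isP two _ = ⊥-elim (¬Fin0 (proj₁ (IsPartition.nonempty isP (fromℕ< two))))
lemma9p9 (suc m) Π isP two _ = mk⇔ aut⇒interwoven interwoven⇒aut
  where
  aut⇒interwoven : InAut ζ Π → InterwovenUnion Π 0 m
  aut⇒interwoven aut =
    let (k₀ , k∣N , residues) = aut⇒residues isP aut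
    in residues⇒interwoven {Π = Π} k₀ (Partition.modulus>1 isP two k₀ residues) k∣N residues
  interwoven⇒aut : InterwovenUnion Π 0 m → InAut ζ Π
  interwoven⇒aut union =
    let (k′ , k∣N , residues) = interwoven⇒residues {Π = Π} union
    in residues⇒aut isP k′ k∣N residues
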